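{- For every two-colored partition $p$, with $\tilde p$ its verticolor reflection, $Z(\{\tilde p\})=(F,-V,-\Sigma,-L,-K,-X)(\{p\})$, i.e. $F(\{\tilde p\})=F(\{p\})$ and $Y(\{\tilde p\})=-Y(\{p\})$ for $Y\in\{V,\Sigma,L,K,X\}$ (where $-A=\{ -a:a\in A\}$).
   Context: A two-colored partition $p$ consists of a lower row $R_L$ and an upper row $R_U$ (disjoint, possibly empty, finite totally ordered sets), a decomposition of $P_p=R_L\cup R_U$ into disjoint nonempty blocks, and a coloring of each point by $\circ$ or $\bullet$. Orientation: the cyclic order on $P_p$ agreeing with the order of $R_L$ on $R_L$, with the reverse order of $R_U$ on $R_U$, with the maximum of $R_U$ succeeding the maximum of $R_L$ and the minimum of $R_L$ succeeding the minimum of $R_U$; intervals $]\alpha,\beta[_p$, $]\alpha,\beta]_p$ for distinct $\alpha,\beta$ refer to this cyclic order. Normalized color: color for lower points, inverse color for upper points. $\sigma_p(S)$: number of normalized-white minus number of normalized-black points of $S$; $\Sigma(p)=\sigma_p(P_p)$. Color distance: $\delta_p(\alpha,\alpha)=\Sigma(p)$; for $\alpha\ne\beta$, $\delta_p(\alpha,\beta)=\sigma_p(]\alpha,\beta[_p)$ if their normalized colors differ and $\sigma_p(]\alpha,\beta]_p)$ if they agree. Blocks $B\neq B'$ cross if there are pairwise distinct $\alpha,\beta\in B$, $\alpha',\beta'\in B'$ appearing in the cyclic order in the order $\alpha,\alpha',\beta,\beta'$. For a set $\mathcal S$ of partitions: $F(\mathcal S)=\{|B|: p\in\mathcal S, B$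 block of $p\}$; $V(\mathcal S)=\{\sigma_p(B): p\in\mathcal S,B$ block of $p\}$; $\Sigma(\mathcal S)=\{\Sigma(p):p\in\mathcal S\}$; $L(\mathcal S)$ (resp. $K(\mathcal S)$) is the set of $\delta_p(\alpha_1,\alpha_2)$ over $p\in\mathcal S$, blocks $B$ of $p$, $\alpha_1\neq\alpha_2\in B$ with $]\alpha_1,\alpha_2[_p\cap B=\emptyset$ and $\sigma_p(\{\alpha_1,\alpha_2\})\neq0$ (resp. $=0$); $X(\mathcal S)$ is the set of $\delta_p(\alpha_1,\alpha_2)$ over $p\in\mathcal S$, crossing blocks $B_1,B_2$ of $p$, $\alpha_1\in B_1,\alpha_2\in B_2$. $Z=(F,V,\Sigma,L,K,X)$. The verticolor reflection $\tilde p$ of $p$ is obtained by reversing the orders of both rows (keeping blocks) and inverting the colors of all points. -}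

module Defs where

open import Data.Nat using (ℕ; zero; suc; _+_; _∸_; _<ᵇ_; _≡ᵇ_)
open import Data.Fin using (Fin; toℕ; opposite)
open import Data.Sum using (_⊎_; inj₁; inj₂)
open import Data.Bool using (Bool; true; false; _∧_; _∨_; not; if_then_else_)
open import Data.List using (List; map; filter; _++_; length; foldr; allFin)
open import Data.Integer using (ℤ; +_; -_) renaming (_+_ to _+ℤ_)
open import Data.Product using (_×_; _,_; ∃; ∃-syntax)
open import Relation.Binary.PropositionalEquality using (_≡_; _≢_)
open import Relation.Nullary using (¬_)
open import Relation.Nullary.Decidable using (does)
import Data.Bool

keep : {A : Set} → (A → Bool) → List A → List A
keep P = filter (λ x → Data.Bool._≟_ (P x) true)

data Color : Set where
  white black : Color     -- white = ∘ , black = •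

invert : Color → Color
invert white = black
invert black = white

-- Points: lower row = Fin k (ordered as Fin), upper row = Fin l.
Point : ℕ → ℕ → Set
Point k l = Fin k ⊎ Fin l

-- A two-colored partition: rows R_L = Fin k, R_U = Fin l, a colouring,
-- and a block decomposition given by block labels (two points are in the
-- same block iff their labels agree; blocks are the nonempty fibres).
record Partition : Set where
  constructor part
  field
    k   : ℕ
    l   : ℕ
    col : Point k l → Color
    blk : Point k l → ℕ
open Partition public

module _ (p : Partition) where
  Pt : Set
  Pt = Point (k p) (l p)

  allPts : List Pt
  allPts = map inj₁ (allFin (k p)) ++ map inj₂ (allFin (l p))

  -- position in the orientation (cyclic order): lower row ascending,
  -- then upper row from its maximum down to its minimum, then back.
  pos : Pt → ℕ
  pos (inj₁ i) = toℕ i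
  pos (inj₂ j) = k p + (l p ∸ suc (toℕ j))

  eqPt : Pt → Pt → Bool
  eqPt x y = pos x ≡ᵇ pos y

  -- γ ∈ ]α,β[_p   (for α ≠ β)
  openInt : Pt → Pt → Pt → Bool
  openInt α β γ with pos α <ᵇ pos β
  ... | true  = (pos α <ᵇ pos γ) ∧ (pos γ <ᵇ pos β)
  ... | false = (pos α <ᵇ pos γ) ∨ (pos γ <ᵇ pos β)

  halfInt : Pt → Pt → Pt → Bool
  halfInt α β γ = openInt α β γ ∨ eqPt γ β

  ncol : Pt → Color
  ncol (inj₁ i) = col p (inj₁ i)
  ncol (inj₂ j) = invert (col p (inj₂ j))

  wt : Pt → ℤ
  wt x with ncol x
  ... | white = + 1
  ... | black = - (+ 1)

  σ : (Pt → Bool) → ℤ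
  σ S = foldr _+ℤ_ (+ 0) (map wt (keep S allPts))

  Σp : ℤ
  Σp = σ (λ _ → true)

  sameCol : Color → Color → Bool
  sameCol white white = true
  sameCol black black = true
  sameCol _ _ = false

  δ : Pt → Pt → ℤ
  δ α β = if eqPt α β then Σp
          else (if sameCol (ncol α) (ncol β) then σ (halfInt α β) else σ (openInt α β))

  blockOf : Pt → Pt → Bool
  blockOf x y = blk p y ≡ᵇ blk p x

  Cross : Pt → Pt → Set
  Cross x y = blk p x ≢ blk p y ×
    ∃[ α ] ∃[ β ] ∃[ α' ] ∃[ β' ]
      (blk p α ≡ blk p x × blk p β ≡ blk p x × blk p α' ≡ blk p y × blk p β' ≡ blk p y ×
       α ≢ β × α' ≢ β' ×
       openInt α β α' ≡ true × openInt β α β' ≡ true)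

-- The invariants Z = (F, V, Σ, L, K, X) of the singleton {p}, as predicates

Fset : Partition → ℕ → Set
Fset p n = ∃[ x ] length (keep (blockOf p x) (allPts p)) ≡ n

Vset : Partition → ℤ → Set
Vset p v = ∃[ x ] σ p (blockOf p x) ≡ v

Σset : Partition → ℤ → Set
Σset p v = Σp p ≡ v

Consec : (p : Partition) → Pt p → Pt p → Set
Consec p α₁ α₂ = α₁ ≢ α₂ × blk p α₁ ≡ blk p α₂ ×
  (∀ γ → openInt p α₁ α₂ γ ≡ true → blk p γ ≢ blk p α₁)

Lset : Partition → ℤ → Set
Lset p v = ∃[ α₁ ] ∃[ α₂ ] (Consec p α₁ α₂ × wt p α₁ +ℤ wt p α₂ ≢ + 0 × δ p α₁ α₂ ≡ v)

Kset : Partition → ℤ → Set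
Kset p v = ∃[ α₁ ] ∃[ α₂ ] (Consec p α₁ α₂ × wt p α₁ +ℤ wt p α₂ ≡ + 0 × δ p α₁ α₂ ≡ v)

Xset : Partition → ℤ → Set
Xset p v = ∃[ α₁ ] ∃[ α₂ ] (Cross p α₁ α₂ × δ p α₁ α₂ ≡ v)

flipPt : ∀ {k l} → Point k l → Point k l
flipPt (inj₁ i) = inj₁ (opposite i)
flipPt (inj₂ j) = inj₂ (opposite j)

verticolor : Partition → Partition
verticolor (part k l c b) = part k l (λ x → invert (c (flipPt x))) (λ x → b (flipPt x))

-- Number the points of p̃ so that x̃ := flipPt x; then p̃ has the blocks of p, negated normalized
-- weights, and its orientation is the reverse of that of p up to rotation: z ∈ ]x,y[_p iff
-- z̃ ∈ ]ỹ,x̃[_p̃. Hence block sizes are kept, every σ changes sign, consecutive and crossing pairs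
-- (α,β) of p correspond to (β̃,α̃) in p̃, and δ_p̃(β̃,α̃) = -δ_p(α,β): for equally coloured α, β
-- the interval ]α,β] turns into [β̃,α̃[, which weighs as much as ]β̃,α̃] because α and β do.
-- The reversal is checked by writing z ∈ ]x,y[ (x ≠ y) as the majority of x < z, z < y, y < x,
-- which reduces it to a case analysis on the rows of x, y, z.

module Submission where

open import Defs
open import Data.Nat using (ℕ; zero; suc; _+_; _<_; _<ᵇ_; _≡ᵇ_; s≤s)
open import Data.Nat.Properties
  using (<ᵇ-reflects-<; <-cmp; <-asym; <-trans; <-irrefl; <-≤-trans; <ᵇ⇒<; <⇒<ᵇ; m≤m+n;
         +-monoʳ-<; +-cancelˡ-<; +-cancelˡ-≡; ∸-monoʳ-<; ≡ᵇ⇒≡; ≡⇒≡ᵇ)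
open import Data.Bool using (Bool; true; false; _∧_; _∨_; not; if_then_else_)
open import Data.Bool.Properties using (T-≡; T-∧; T-∨; ∨-zeroʳ; ∨-identityʳ; ¬-not; ⇔→≡)
open import Data.Fin using (Fin; zero; suc; toℕ; opposite; inject₁; fromℕ)
open import Data.Fin.Properties using (opposite-prop; opposite-involutive; toℕ<n; toℕ-injective; _≟_)
open import Data.Sum using (inj₁; inj₂)
open import Data.Product using (_×_; _,_)
open import Data.Empty using (⊥-elim)
open import Function using (_∘_)
open import Function.Bundles using (_⇔_; mk⇔; Equivalence)
open import Relation.Binary.Definitions using (tri<; tri≈; tri>)
open import Relation.Binary.PropositionalEquality
open import Relation.Nullary using (¬_; yes; no)
open import Relation.Nullary.Reflects using (ofʸ; ofⁿ; det; fromEquivalence)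
open import Data.List using (List; []; _∷_; _∷ʳ_; _++_; tabulate; map; foldr; length)
open import Data.List.Properties using (map-tabulate; map-++; map-∘; map-cong; length-map)
open import Data.List.Membership.Propositional using (_∈_)
open import Data.List.Membership.Propositional.Properties
  using (∈-tabulate⁺; ∈-tabulate⁻; ∈-++⁺ˡ; ∈-++⁺ʳ)
open import Data.List.Relation.Unary.All as All using (All; []; _∷_)
open import Data.List.Relation.Unary.Any using (here; there)
open import Data.List.Relation.Unary.AllPairs using (_∷_)
open import Data.List.Relation.Unary.Unique.Propositional using (Unique)
import Data.List.Relation.Unary.Unique.Propositional.Properties as Unique
open import Data.List.Relation.Binary.Permutation.Propositional
  using (_↭_; ↭-refl; ↭-sym; ↭-trans; ↭-prep; ↭-reflexive; ↭⇒↭ₛ)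
open import Data.List.Relation.Binary.Permutation.Propositional.Properties
  using (∷↭∷ʳ; ++⁺; map⁺; filter-↭; ↭-length)
open import Data.Integer using (ℤ; 0ℤ; 1ℤ; -1ℤ; -_) renaming (_+_ to _+ℤ_)
open import Data.Integer.Properties
  using (+-0-isCommutativeMonoid; neg-distrib-+; neg-involutive; neg-injective; +-assoc; +-comm)
open import Data.List.Relation.Binary.Permutation.Setoid.Properties (setoid ℤ) using (foldr-commMonoid)
open import Data.Sum.Properties using (inj₁-injective; inj₂-injective; ≡-dec)

open Equivalence using (to; from)

maj : Bool → Bool → Bool → Bool
maj true  true  _ = true
maj false false _ = false
maj true  false c = c
maj false true  c = c

maj-comm : ∀ a b c → maj a b c ≡ maj b a c
maj-comm true  true  c = refl
maj-comm true  false c = refl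
maj-comm false true  c = refl
maj-comm false false c = refl

maj-rotate : ∀ a b c → maj a b c ≡ maj b c a
maj-rotate true  true  true  = refl
maj-rotate true  true  false = refl
maj-rotate true  false true  = refl
maj-rotate true  false false = refl
maj-rotate false true  true  = refl
maj-rotate false true  false = refl
maj-rotate false false true  = refl
maj-rotate false false false = refl

if-∧-∨-maj : ∀ u a b → (if u then a ∧ b else a ∨ b) ≡ maj a b (not u)
if-∧-∨-maj true  true  true  = refl
if-∧-∨-maj true  true  false = refl
if-∧-∨-maj true  false true  = refl
if-∧-∨-maj true  false false = refl
if-∧-∨-maj false true  true  = refl
if-∧-∨-maj false true  false = refl
if-∧-∨-maj false false true  = refl
if-∧-∨-maj false false false = refl

-- Cyclic order on ℕ

<ᵇ-true : ∀ {m n} → m < n → (m <ᵇ n) ≡ true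
<ᵇ-true {m} {n} m<n = det (<ᵇ-reflects-< m n) (ofʸ m<n)

<ᵇ-false : ∀ {m n} → ¬ m < n → (m <ᵇ n) ≡ false
<ᵇ-false {m} {n} m≮n = det (<ᵇ-reflects-< m n) (ofⁿ m≮n)

<ᵇ-irrefl : ∀ n → (n <ᵇ n) ≡ false
<ᵇ-irrefl n = <ᵇ-false {n} {n} (<-irrefl refl)

<ᵇ-cong-⇔ : ∀ {m n m′ n′} → m < n ⇔ m′ < n′ → (m <ᵇ n) ≡ (m′ <ᵇ n′)
<ᵇ-cong-⇔ {m} {n} {m′} {n′} m<n⇔ =
  det (<ᵇ-reflects-< m n) (fromEquivalence (from m<n⇔ ∘ <ᵇ⇒< m′ n′) (<⇒<ᵇ ∘ to m<n⇔))

<ᵇ-swap : ∀ {m n} → m ≢ n → (n <ᵇ m) ≡ not (m <ᵇ n)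
<ᵇ-swap {m} {n} m≢n with <-cmp m n
... | tri< m<n _ n≮m = trans (<ᵇ-false n≮m) (cong not (sym (<ᵇ-true m<n)))
... | tri≈ _ m≡n _   = ⊥-elim (m≢n m≡n)
... | tri> m≮n _ n<m = trans (<ᵇ-true n<m) (cong not (sym (<ᵇ-false m≮n)))

inArc : ℕ → ℕ → ℕ → Bool
inArc m n o = if m <ᵇ n then (m <ᵇ o) ∧ (o <ᵇ n) else (m <ᵇ o) ∨ (o <ᵇ n)

inArc-< : ∀ {m n} o → m < n → inArc m n o ≡ (m <ᵇ o) ∧ (o <ᵇ n)
inArc-< o m<n rewrite <ᵇ-true m<n = refl

inArc-> : ∀ {m n} o → n < m → inArc m n o ≡ (m <ᵇ o) ∨ (o <ᵇ n)
inArc-> o n<m rewrite <ᵇ-false (<-asym n<m) = refl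

inArc-maj : ∀ {m n} o → m ≢ n → inArc m n o ≡ maj (m <ᵇ o) (o <ᵇ n) (n <ᵇ m)
inArc-maj {m} {n} o m≢n =
  trans (if-∧-∨-maj (m <ᵇ n) (m <ᵇ o) (o <ᵇ n)) (cong (maj _ _) (sym (<ᵇ-swap m≢n)))

inArc-start : ∀ m n → inArc m n m ≡ false
inArc-start m n rewrite <ᵇ-irrefl m with m <ᵇ n
... | true  = refl
... | false = refl

inArc-end : ∀ m n → inArc m n n ≡ false
inArc-end m n rewrite <ᵇ-irrefl n with m <ᵇ n
... | true  = refl
... | false = refl

data Cyclic (a b c : ℕ) : Set where
  abc : a < b → b < c → Cyclic a b c
  bca : b < c → c < a → Cyclic a b c
  cab : c < a → a < b → Cyclic a b c

Cyclic-rotate : ∀ {a b c} → Cyclic a b c → Cyclic b c a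
Cyclic-rotate (abc a<b b<c) = cab a<b b<c
Cyclic-rotate (bca b<c c<a) = abc b<c c<a
Cyclic-rotate (cab c<a a<b) = bca c<a a<b

-- Gluing the triangles (a,b,c) and (a,c,d) along the chord ac gives a cyclic quadrilateral.
Cyclic-glue : ∀ {a b c d} → Cyclic a b c → Cyclic a c d → Cyclic b c d × Cyclic a b d
Cyclic-glue (abc a<b b<c) (abc _ c<d)   = abc b<c c<d , abc a<b (<-trans b<c c<d)
Cyclic-glue (abc a<b b<c) (bca c<d d<a) = ⊥-elim (<-asym (<-trans a<b b<c) (<-trans c<d d<a))
Cyclic-glue (abc a<b b<c) (cab d<a _)   = cab (<-trans d<a a<b) b<c , cab d<a a<b
Cyclic-glue (bca _ c<a)   (abc a<c _)   = ⊥-elim (<-asym a<c c<a)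
Cyclic-glue (bca b<c _)   (bca c<d d<a) = abc b<c c<d , bca (<-trans b<c c<d) d<a
Cyclic-glue (bca _ c<a)   (cab _ a<c)   = ⊥-elim (<-asym a<c c<a)
Cyclic-glue (cab c<a _)   (abc a<c _)   = ⊥-elim (<-asym a<c c<a)
Cyclic-glue (cab _ a<b)   (bca c<d d<a) = bca c<d (<-trans d<a a<b) , cab d<a a<b
Cyclic-glue (cab c<a _)   (cab _ a<c)   = ⊥-elim (<-asym a<c c<a)

inArc⇒Cyclic : ∀ {m n o} → m ≢ n → inArc m n o ≡ true → Cyclic m o n
inArc⇒Cyclic {m} {n} {o} m≢n inArc≡true with <-cmp m n
... | tri≈ _ m≡n _ = ⊥-elim (m≢n m≡n)
... | tri< m<n _ _
  with m<o , o<n ← to T-∧ (from T-≡ (trans (sym (inArc-< o m<n)) inArc≡true))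
  = abc (<ᵇ⇒< m o m<o) (<ᵇ⇒< o n o<n)
... | tri> _ _ n<m with to T-∨ (from T-≡ (trans (sym (inArc-> o n<m)) inArc≡true))
... | inj₁ m<o = cab n<m (<ᵇ⇒< m o m<o)
... | inj₂ o<n = bca (<ᵇ⇒< o n o<n) n<m

Cyclic⇒inArc : ∀ {m n o} → Cyclic m o n → inArc m n o ≡ true
Cyclic⇒inArc {m} {n} {o} (abc m<o o<n) =
  trans (inArc-< o (<-trans m<o o<n)) (cong₂ _∧_ (<ᵇ-true m<o) (<ᵇ-true o<n))
Cyclic⇒inArc {m} {n} {o} (bca o<n n<m) =
  trans (inArc-> o n<m) (trans (cong ((m <ᵇ o) ∨_) (<ᵇ-true o<n)) (∨-zeroʳ (m <ᵇ o)))
Cyclic⇒inArc {m} {n} {o} (cab n<m m<o) = trans (inArc-> o n<m) (cong (_∨ (o <ᵇ n)) (<ᵇ-true m<o))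

-- Orientation of the points

opposite-injective : ∀ {n} {i j : Fin n} → opposite i ≡ opposite j → i ≡ j
opposite-injective {i = i} {j} e =
  trans (sym (opposite-involutive i)) (trans (cong opposite e) (opposite-involutive j))

opposite-< : ∀ {n} {i j : Fin n} → toℕ i < toℕ j → toℕ (opposite j) < toℕ (opposite i)
opposite-< {i = i} {j} i<j rewrite opposite-prop i | opposite-prop j = ∸-monoʳ-< (s≤s i<j) (toℕ<n j)

opposite-<ᵇ : ∀ {n} (i j : Fin n) → (toℕ (opposite i) <ᵇ toℕ (opposite j)) ≡ (toℕ j <ᵇ toℕ i)
opposite-<ᵇ i j = <ᵇ-cong-⇔ (mk⇔ (back ∘ opposite-<) opposite-<)
  where back = subst₂ (λ a b → toℕ a < toℕ b) (opposite-involutive j) (opposite-involutive i)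

tabulate-∷ʳ : ∀ {A : Set} {n} (g : Fin (suc n) → A) →
  tabulate g ≡ tabulate (g ∘ inject₁) ∷ʳ g (fromℕ n)
tabulate-∷ʳ {n = zero}  g = refl
tabulate-∷ʳ {n = suc n} g = cong (g zero ∷_) (tabulate-∷ʳ (λ i → g (suc i)))

tabulate-opposite-↭ : ∀ {A : Set} {n} (g : Fin n → A) → tabulate (g ∘ opposite) ↭ tabulate g
tabulate-opposite-↭ {n = zero}  g = ↭-refl
tabulate-opposite-↭ {n = suc n} g =
  ↭-trans (↭-prep (g (fromℕ n)) (tabulate-opposite-↭ (g ∘ inject₁)))
          (↭-trans (∷↭∷ʳ (g (fromℕ n)) (tabulate (g ∘ inject₁)))
                   (↭-reflexive (sym (tabulate-∷ʳ g))))

flipPt-involutive : ∀ {k l} (x : Point k l) → flipPt (flipPt x) ≡ x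
flipPt-involutive (inj₁ i) = cong inj₁ (opposite-involutive i)
flipPt-involutive (inj₂ j) = cong inj₂ (opposite-involutive j)

flipPt-injective : ∀ {k l} {x y : Point k l} → flipPt x ≡ flipPt y → x ≡ y
flipPt-injective {x = x} {y} e =
  trans (sym (flipPt-involutive x)) (trans (cong flipPt e) (flipPt-involutive y))

flipPt-≢ : ∀ {k l} {x y : Point k l} → x ≢ y → flipPt x ≢ flipPt y
flipPt-≢ x≢y = x≢y ∘ flipPt-injective

precedes : ∀ {k l} → Point k l → Point k l → Bool
precedes (inj₁ i) (inj₁ j) = toℕ i <ᵇ toℕ j
precedes (inj₁ _) (inj₂ _) = true
precedes (inj₂ _) (inj₁ _) = false
precedes (inj₂ i) (inj₂ j) = toℕ j <ᵇ toℕ i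

-- Reflecting both rows reverses the order within each row but keeps the lower row first.
maj-precedes-flipPt : ∀ {k l} (x y z : Point k l) →
  maj (precedes (flipPt y) (flipPt z)) (precedes (flipPt z) (flipPt x)) (precedes (flipPt x) (flipPt y))
  ≡ maj (precedes x z) (precedes z y) (precedes y x)
maj-precedes-flipPt (inj₁ i) (inj₁ j) (inj₁ m)
  rewrite opposite-<ᵇ j m | opposite-<ᵇ m i | opposite-<ᵇ i j
  = maj-comm (toℕ m <ᵇ toℕ j) (toℕ i <ᵇ toℕ m) (toℕ j <ᵇ toℕ i)
maj-precedes-flipPt (inj₂ i) (inj₂ j) (inj₂ m)
  rewrite opposite-<ᵇ m j | opposite-<ᵇ i m | opposite-<ᵇ j i
  = maj-comm (toℕ j <ᵇ toℕ m) (toℕ m <ᵇ toℕ i) (toℕ i <ᵇ toℕ j)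
maj-precedes-flipPt (inj₁ i) (inj₁ j) (inj₂ m) rewrite opposite-<ᵇ i j = refl
maj-precedes-flipPt (inj₂ i) (inj₂ j) (inj₁ m) rewrite opposite-<ᵇ j i = refl
maj-precedes-flipPt (inj₁ i) (inj₂ j) (inj₁ m) rewrite opposite-<ᵇ m i = maj-rotate false _ true
maj-precedes-flipPt (inj₂ i) (inj₁ j) (inj₂ m) rewrite opposite-<ᵇ i m = maj-rotate true _ false
maj-precedes-flipPt (inj₂ i) (inj₁ j) (inj₁ m) rewrite opposite-<ᵇ j m = sym (maj-rotate false _ true)
maj-precedes-flipPt (inj₁ i) (inj₂ j) (inj₂ m) rewrite opposite-<ᵇ m j = sym (maj-rotate true _ false)

pos-upper : ∀ r (j : Fin (l r)) → pos r (inj₂ j) ≡ k r + toℕ (opposite j)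
pos-upper r j = cong (k r +_) (sym (opposite-prop j))

pos-lower<upper : ∀ r (i : Fin (k r)) (j : Fin (l r)) → pos r (inj₁ i) < pos r (inj₂ j)
pos-lower<upper r i j = <-≤-trans (toℕ<n i) (m≤m+n (k r) _)

pos-injective : ∀ r {x y : Pt r} → pos r x ≡ pos r y → x ≡ y
pos-injective r {inj₁ i} {inj₁ j} e = cong inj₁ (toℕ-injective e)
pos-injective r {inj₁ i} {inj₂ j} e = ⊥-elim (<-irrefl e (pos-lower<upper r i j))
pos-injective r {inj₂ i} {inj₁ j} e = ⊥-elim (<-irrefl (sym e) (pos-lower<upper r j i))
pos-injective r {inj₂ i} {inj₂ j} e = cong inj₂ (opposite-injective (toℕ-injective
  (+-cancelˡ-≡ (k r) _ _ (trans (sym (pos-upper r i)) (trans e (pos-upper r j))))))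

pos-<ᵇ : ∀ r (x y : Pt r) → (pos r x <ᵇ pos r y) ≡ precedes x y
pos-<ᵇ r (inj₁ i) (inj₁ j) = refl
pos-<ᵇ r (inj₁ i) (inj₂ j) = <ᵇ-true (pos-lower<upper r i j)
pos-<ᵇ r (inj₂ i) (inj₁ j) = <ᵇ-false (<-asym (pos-lower<upper r j i))
pos-<ᵇ r (inj₂ i) (inj₂ j) = begin
  (pos r (inj₂ i) <ᵇ pos r (inj₂ j))
    ≡⟨ cong₂ _<ᵇ_ (pos-upper r i) (pos-upper r j) ⟩
  (k r + toℕ (opposite i) <ᵇ k r + toℕ (opposite j))
    ≡⟨ <ᵇ-cong-⇔ (mk⇔ (+-cancelˡ-< (k r) _ _) (+-monoʳ-< (k r))) ⟩
  (toℕ (opposite i) <ᵇ toℕ (opposite j))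
    ≡⟨ opposite-<ᵇ i j ⟩
  (toℕ j <ᵇ toℕ i)
    ∎
  where open ≡-Reasoning

eqPt-≡true : ∀ r (x y : Pt r) → eqPt r x y ≡ true ⇔ x ≡ y
eqPt-≡true r x y = mk⇔ (pos-injective r ∘ ≡ᵇ⇒≡ (pos r x) (pos r y) ∘ from T-≡)
                       (to T-≡ ∘ ≡⇒≡ᵇ (pos r x) (pos r y) ∘ cong (pos r))

openInt-inArc : ∀ r (x y z : Pt r) → openInt r x y z ≡ inArc (pos r x) (pos r y) (pos r z)
openInt-inArc r x y z with pos r x <ᵇ pos r y
... | true  = refl
... | false = refl

openInt-start : ∀ r (x y : Pt r) → openInt r x y x ≡ false
openInt-start r x y = trans (openInt-inArc r x y x) (inArc-start (pos r x) (pos r y))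

openInt-end : ∀ r (x y : Pt r) → openInt r x y y ≡ false
openInt-end r x y = trans (openInt-inArc r x y y) (inArc-end (pos r x) (pos r y))

openInt-maj : ∀ r {x y : Pt r} → x ≢ y → ∀ z →
  openInt r x y z ≡ maj (precedes x z) (precedes z y) (precedes y x)
openInt-maj r {x} {y} x≢y z
  rewrite openInt-inArc r x y z | inArc-maj (pos r z) (x≢y ∘ pos-injective r)
        | pos-<ᵇ r x z | pos-<ᵇ r z y | pos-<ᵇ r y x = refl

openInt⇒Cyclic : ∀ r {x y z : Pt r} → x ≢ y → openInt r x y z ≡ true →
  Cyclic (pos r x) (pos r z) (pos r y)
openInt⇒Cyclic r {x} {y} {z} x≢y z∈xy =
  inArc⇒Cyclic (x≢y ∘ pos-injective r) (trans (sym (openInt-inArc r x y z)) z∈xy)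

Cyclic⇒openInt : ∀ r {x y z : Pt r} → Cyclic (pos r x) (pos r z) (pos r y) → openInt r x y z ≡ true
Cyclic⇒openInt r {x} {y} {z} xzy = trans (openInt-inArc r x y z) (Cyclic⇒inArc xzy)

openInt-crossing : ∀ r {a b a′ b′ : Pt r} → a ≢ b →
  openInt r a b a′ ≡ true → openInt r b a b′ ≡ true →
  openInt r a′ b′ b ≡ true × openInt r b′ a′ a ≡ true
openInt-crossing r {a} {b} {a′} {b′} a≢b a′∈ab b′∈ba
  with a′bb′ , aa′b′ ← Cyclic-glue
         (openInt⇒Cyclic r a≢b a′∈ab)
         (Cyclic-rotate (Cyclic-rotate (openInt⇒Cyclic r (a≢b ∘ sym) b′∈ba)))
  = Cyclic⇒openInt r {a′} {b′} {b} a′bb′ ,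
    Cyclic⇒openInt r {b′} {a′} {a} (Cyclic-rotate (Cyclic-rotate aa′b′))

-- Sums over the points

sumℤ : List ℤ → ℤ
sumℤ = foldr _+ℤ_ 0ℤ

sumℤ-↭ : ∀ {xs ys} → xs ↭ ys → sumℤ xs ≡ sumℤ ys
sumℤ-↭ = foldr-commMonoid +-0-isCommutativeMonoid ∘ ↭⇒↭ₛ

sumℤ-neg : ∀ xs → sumℤ (map -_ xs) ≡ - sumℤ xs
sumℤ-neg []       = refl
sumℤ-neg (x ∷ xs) = trans (cong (- x +ℤ_) (sumℤ-neg xs)) (sym (neg-distrib-+ x (sumℤ xs)))

keep-map : ∀ {A B : Set} (S : B → Bool) (g : A → B) xs → keep S (map g xs) ≡ map g (keep (S ∘ g) xs)
keep-map S g []       = refl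
keep-map S g (x ∷ xs) with S (g x)
... | true  = cong (g x ∷_) (keep-map S g xs)
... | false = keep-map S g xs

keep-cong : ∀ {A : Set} {S S′ : A → Bool} {xs} → All (λ x → S x ≡ S′ x) xs →
  keep S xs ≡ keep S′ xs
keep-cong                  []       = refl
keep-cong {S = S} {S′} {x ∷ _} (e ∷ es) with S x | S′ x | e
... | true  | .true  | refl = cong (x ∷_) (keep-cong es)
... | false | .false | refl = keep-cong es

sumℤ-keep-∨-singleton : ∀ {A : Set} (g : A → ℤ) (S E : A → Bool) {a : A} →
  (∀ {x} → E x ≡ true ⇔ x ≡ a) → S a ≡ false → ∀ {xs} → Unique xs → a ∈ xs →
  sumℤ (map g (keep (λ x → S x ∨ E x) xs)) ≡ sumℤ (map g (keep S xs)) +ℤ g a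
sumℤ-keep-∨-singleton g S E {a} E⇔ Sa {a ∷ xs} (a∉xs ∷ _) (here refl)
  with S a | E a | Sa | from E⇔ refl
... | .false | .true | refl | refl =
  trans (cong (λ ys → g a +ℤ sumℤ (map g ys)) (keep-cong (All.map (S∨E≡S ∘ (_∘ sym)) a∉xs)))
        (+-comm (g a) _)
  where
  S∨E≡S : ∀ {x} → x ≢ a → (S x ∨ E x) ≡ S x
  S∨E≡S {x} x≢a with E x in Ex
  ... | true  = ⊥-elim (x≢a (to E⇔ Ex))
  ... | false = ∨-identityʳ (S x)
sumℤ-keep-∨-singleton g S E {a} E⇔ Sa {x ∷ xs} (x∉xs ∷ uniq) (there a∈xs)
  with S x | E x in Ex
... | _     | true  = ⊥-elim (All.lookup x∉xs a∈xs (to E⇔ Ex))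
... | true  | false = trans (cong (g x +ℤ_) (sumℤ-keep-∨-singleton g S E E⇔ Sa uniq a∈xs))
                            (sym (+-assoc (g x) _ (g a)))
... | false | false = sumℤ-keep-∨-singleton g S E E⇔ Sa uniq a∈xs

allPts-tabulate : ∀ r → allPts r ≡ tabulate inj₁ ++ tabulate inj₂
allPts-tabulate r = cong₂ _++_ (map-tabulate (λ i → i) inj₁) (map-tabulate (λ j → j) inj₂)

allPts-unique : ∀ r → Unique (allPts r)
allPts-unique r = subst Unique (sym (allPts-tabulate r))
  (Unique.++⁺ (Unique.tabulate⁺ inj₁-injective) (Unique.tabulate⁺ inj₂-injective) lower∩upper≡∅)
  where
  lower∩upper≡∅ : ∀ {x} → ¬ (x ∈ tabulate {n = k r} inj₁ × x ∈ tabulate {n = l r} inj₂)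
  lower∩upper≡∅ (x∈lower , x∈upper) with ∈-tabulate⁻ x∈lower | ∈-tabulate⁻ x∈upper
  ... | _ , refl | _ , ()

∈-allPts : ∀ r (x : Pt r) → x ∈ allPts r
∈-allPts r x rewrite allPts-tabulate r with x
... | inj₁ i = ∈-++⁺ˡ (∈-tabulate⁺ i)
... | inj₂ j = ∈-++⁺ʳ (tabulate inj₁) (∈-tabulate⁺ j)

allPts-↭-flipPt : ∀ r → map flipPt (allPts r) ↭ allPts r
allPts-↭-flipPt r = ↭-trans (↭-reflexive flipped)
  (↭-trans (++⁺ (tabulate-opposite-↭ inj₁) (tabulate-opposite-↭ inj₂))
           (↭-reflexive (sym (allPts-tabulate r))))
  where
  flipped : map flipPt (allPts r) ≡ tabulate (inj₁ ∘ opposite) ++ tabulate (inj₂ ∘ opposite)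
  flipped = trans (cong (map flipPt) (allPts-tabulate r))
    (trans (map-++ flipPt (tabulate inj₁) (tabulate inj₂))
           (cong₂ _++_ (map-tabulate inj₁ flipPt) (map-tabulate inj₂ flipPt)))

sumℤ-keep-flipPt : ∀ r (g : Pt r → ℤ) (S : Pt r → Bool) →
  sumℤ (map g (keep S (allPts r))) ≡ sumℤ (map (g ∘ flipPt) (keep (S ∘ flipPt) (allPts r)))
sumℤ-keep-flipPt r g S =
  trans (sumℤ-↭ (map⁺ g (filter-↭ _ (↭-sym (allPts-↭-flipPt r)))))
        (cong sumℤ (trans (cong (map g) (keep-map S flipPt (allPts r))) (sym (map-∘ _))))

length-keep-flipPt : ∀ r (S : Pt r → Bool) →
  length (keep S (allPts r)) ≡ length (keep (S ∘ flipPt) (allPts r))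
length-keep-flipPt r S =
  trans (↭-length (filter-↭ _ (↭-sym (allPts-↭-flipPt r))))
        (trans (cong length (keep-map S flipPt (allPts r)))
               (length-map flipPt (keep (S ∘ flipPt) (allPts r))))

keep-allPts-cong : ∀ r {S S′ : Pt r → Bool} → (∀ x → S x ≡ S′ x) →
  keep S (allPts r) ≡ keep S′ (allPts r)
keep-allPts-cong r S≗S′ = keep-cong {xs = allPts r} (All.tabulate (λ {x} _ → S≗S′ x))

σ-cong : ∀ r {S S′ : Pt r → Bool} → (∀ x → S x ≡ S′ x) → σ r S ≡ σ r S′
σ-cong r S≗S′ = cong (sumℤ ∘ map (wt r)) (keep-allPts-cong r S≗S′)

σ-insert : ∀ r {S : Pt r → Bool} (a : Pt r) → S a ≡ false →
  σ r (λ x → S x ∨ eqPt r x a) ≡ σ r S +ℤ wt r a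
σ-insert r {S} a Sa = sumℤ-keep-∨-singleton (wt r) S (λ x → eqPt r x a) (λ {x} → eqPt-≡true r x a) Sa
                                            (allPts-unique r) (∈-allPts r a)

-- Colours and colour distance

weight : Color → ℤ
weight white = 1ℤ
weight black = -1ℤ

wt-weight : ∀ r (x : Pt r) → wt r x ≡ weight (ncol r x)
wt-weight r x with ncol r x
... | white = refl
... | black = refl

weight-invert : ∀ u → weight (invert u) ≡ - weight u
weight-invert white = refl
weight-invert black = refl

invert-involutive : ∀ u → invert (invert u) ≡ u
invert-involutive white = refl
invert-involutive black = refl

sameCol-invert : ∀ r r′ u v → sameCol r (invert u) (invert v) ≡ sameCol r′ v u
sameCol-invert r r′ white white = refl
sameCol-invert r r′ white black = refl
sameCol-invert r r′ black white = refl
sameCol-invert r r′ black black = refl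

sameCol-weight : ∀ r {u v} → sameCol r u v ≡ true → weight u ≡ weight v
sameCol-weight r {white} {white} _ = refl
sameCol-weight r {black} {black} _ = refl

ncol-verticolor : ∀ {k l} (c : Point k l → Color) (b : Point k l → ℕ) x →
  ncol (verticolor (part k l c b)) x ≡ invert (ncol (part k l c b) (flipPt x))
ncol-verticolor c b (inj₁ i) = refl
ncol-verticolor c b (inj₂ j) = refl

δ-self : ∀ r (x : Pt r) → δ r x x ≡ Σp r
δ-self r x rewrite from (eqPt-≡true r x x) refl = refl

δ-distinct : ∀ r {x y : Pt r} → x ≢ y →
  δ r x y ≡ (if sameCol r (ncol r x) (ncol r y) then σ r (halfInt r x y) else σ r (openInt r x y))
δ-distinct r {x} {y} x≢y rewrite ¬-not (x≢y ∘ to (eqPt-≡true r x y)) = refl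

-- Mirror images: r′ is a verticolor reflection of r up to pointwise equality. Both (p, p̃) and
-- (p̃, p) are instances, as verticolor is an involution only up to pointwise equality.
module Mirror {k l : ℕ} {c c′ : Point k l → Color} {b b′ : Point k l → ℕ}
  (ncol-mirror : ∀ x → ncol (part k l c′ b′) (flipPt x) ≡ invert (ncol (part k l c b) x))
  (blk-mirror : ∀ x → b′ (flipPt x) ≡ b x)
  where

  private
    r r′ : Partition
    r  = part k l c b
    r′ = part k l c′ b′

  blk-mirror-≡ : ∀ {x y} → b x ≡ b y → b′ (flipPt x) ≡ b′ (flipPt y)
  blk-mirror-≡ {x} {y} bx≡by = trans (blk-mirror x) (trans bx≡by (sym (blk-mirror y)))

  block-mirror : ∀ x y → blockOf r′ (flipPt x) (flipPt y) ≡ blockOf r x y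
  block-mirror x y = cong₂ _≡ᵇ_ (blk-mirror y) (blk-mirror x)

  wt-mirror : ∀ x → wt r′ (flipPt x) ≡ - wt r x
  wt-mirror x = begin
    wt r′ (flipPt x)                ≡⟨ wt-weight r′ (flipPt x) ⟩
    weight (ncol r′ (flipPt x))     ≡⟨ cong weight (ncol-mirror x) ⟩
    weight (invert (ncol r x))      ≡⟨ weight-invert (ncol r x) ⟩
    - weight (ncol r x)             ≡⟨ cong -_ (wt-weight r x) ⟨
    - wt r x                        ∎
    where open ≡-Reasoning

  wt-pair-mirror : ∀ x y → wt r′ (flipPt y) +ℤ wt r′ (flipPt x) ≡ - (wt r x +ℤ wt r y)
  wt-pair-mirror x y = trans (cong₂ _+ℤ_ (wt-mirror y) (wt-mirror x))
                             (trans (+-comm (- wt r y) (- wt r x)) (sym (neg-distrib-+ (wt r x) (wt r y))))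

  σ-mirror : ∀ S → σ r′ S ≡ - σ r (S ∘ flipPt)
  σ-mirror S = begin
    σ r′ S                              ≡⟨ sumℤ-keep-flipPt r′ (wt r′) S ⟩
    sumℤ (map (wt r′ ∘ flipPt) xs)      ≡⟨ cong sumℤ (map-cong wt-mirror xs) ⟩
    sumℤ (map (-_ ∘ wt r) xs)           ≡⟨ cong sumℤ (map-∘ xs) ⟩
    sumℤ (map -_ (map (wt r) xs))       ≡⟨ sumℤ-neg (map (wt r) xs) ⟩
    - σ r (S ∘ flipPt)                  ∎
    where
    open ≡-Reasoning
    xs = keep (S ∘ flipPt) (allPts r)

  openInt-mirror : ∀ {x y} → x ≢ y → ∀ z → openInt r x y z ≡ openInt r′ (flipPt y) (flipPt x) (flipPt z)
  openInt-mirror {x} {y} x≢y z =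
    trans (openInt-maj r x≢y z)
          (trans (sym (maj-precedes-flipPt x y z))
                 (sym (openInt-maj r′ (flipPt-≢ (x≢y ∘ sym)) (flipPt z))))

  eqPt-mirror : ∀ x y → eqPt r′ (flipPt x) (flipPt y) ≡ eqPt r x y
  eqPt-mirror x y = ⇔→≡ (mk⇔ (from (eqPt-≡true r x y) ∘ flipPt-injective ∘ to flipped)
                              (from flipped ∘ cong flipPt ∘ to (eqPt-≡true r x y)))
    where flipped = eqPt-≡true r′ (flipPt x) (flipPt y)

  σ-openInt-mirror : ∀ {x y} → x ≢ y →
    σ r′ (openInt r′ (flipPt y) (flipPt x)) ≡ - σ r (openInt r x y)
  σ-openInt-mirror x≢y = trans (σ-mirror _) (cong -_ (σ-cong r (sym ∘ openInt-mirror x≢y)))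

  -- ]ỹ,x̃] is the mirror image of [x,y[, which weighs as much as ]x,y] when x and y do.
  σ-halfInt-mirror : ∀ {x y} → x ≢ y → wt r x ≡ wt r y →
    σ r′ (halfInt r′ (flipPt y) (flipPt x)) ≡ - σ r (halfInt r x y)
  σ-halfInt-mirror {x} {y} x≢y wx≡wy = begin
    σ r′ (halfInt r′ (flipPt y) (flipPt x))
      ≡⟨ σ-mirror _ ⟩
    - σ r (λ z → openInt r′ (flipPt y) (flipPt x) (flipPt z) ∨ eqPt r′ (flipPt z) (flipPt x))
      ≡⟨ cong -_ (σ-cong r (λ z → cong₂ _∨_ (sym (openInt-mirror x≢y z)) (eqPt-mirror z x))) ⟩
    - σ r (λ z → openInt r x y z ∨ eqPt r z x)
      ≡⟨ cong -_ (σ-insert r x (openInt-start r x y)) ⟩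
    - (σ r (openInt r x y) +ℤ wt r x)
      ≡⟨ cong (λ w → - (σ r (openInt r x y) +ℤ w)) wx≡wy ⟩
    - (σ r (openInt r x y) +ℤ wt r y)
      ≡⟨ cong -_ (σ-insert r y (openInt-end r x y)) ⟨
    - σ r (halfInt r x y)
      ∎
    where open ≡-Reasoning

  δ-mirror : ∀ x y → δ r′ (flipPt y) (flipPt x) ≡ - δ r x y
  δ-mirror x y with ≡-dec _≟_ _≟_ x y
  ... | yes refl = trans (δ-self r′ (flipPt x)) (trans (σ-mirror _) (cong -_ (sym (δ-self r x))))
  ... | no x≢y = begin
    δ r′ (flipPt y) (flipPt x)
      ≡⟨ δ-distinct r′ (flipPt-≢ (x≢y ∘ sym)) ⟩
    (if sameCol r′ (ncol r′ (flipPt y)) (ncol r′ (flipPt x)) then σ r′ halfInt′ else σ r′ openInt′)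
      ≡⟨ cong (λ s → if s then σ r′ halfInt′ else σ r′ openInt′) sameCol-mirror ⟩
    (if sameCol r (ncol r x) (ncol r y) then σ r′ halfInt′ else σ r′ openInt′)
      ≡⟨ by-colours (sameCol r (ncol r x) (ncol r y)) refl ⟩
    - (if sameCol r (ncol r x) (ncol r y) then σ r (halfInt r x y) else σ r (openInt r x y))
      ≡⟨ cong -_ (δ-distinct r x≢y) ⟨
    - δ r x y ∎
    where
    open ≡-Reasoning
    halfInt′ = halfInt r′ (flipPt y) (flipPt x)
    openInt′ = openInt r′ (flipPt y) (flipPt x)

    sameCol-mirror :
      sameCol r′ (ncol r′ (flipPt y)) (ncol r′ (flipPt x)) ≡ sameCol r (ncol r x) (ncol r y)
    sameCol-mirror = trans (cong₂ (sameCol r′) (ncol-mirror y) (ncol-mirror x)) (sameCol-invert r′ r _ _)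

    by-colours : ∀ s → sameCol r (ncol r x) (ncol r y) ≡ s →
      (if s then σ r′ halfInt′ else σ r′ openInt′) ≡
      - (if s then σ r (halfInt r x y) else σ r (openInt r x y))
    by-colours true  same = σ-halfInt-mirror x≢y
      (trans (wt-weight r x) (trans (sameCol-weight r same) (sym (wt-weight r y))))
    by-colours false _    = σ-openInt-mirror x≢y

  Consec-mirror : ∀ {x y} → Consec r x y → Consec r′ (flipPt y) (flipPt x)
  Consec-mirror {x} {y} (x≢y , bx≡by , gap) =
    flipPt-≢ (x≢y ∘ sym) , blk-mirror-≡ (sym bx≡by) , gap′
    where
    gap′ : ∀ z → openInt r′ (flipPt y) (flipPt x) z ≡ true → b′ z ≢ b′ (flipPt y)
    gap′ z z∈yx b′z≡b′y = gap (flipPt z)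
      (trans (openInt-mirror x≢y (flipPt z))
             (trans (cong (openInt r′ (flipPt y) (flipPt x)) (flipPt-involutive z)) z∈yx))
      (begin
        b (flipPt z)               ≡⟨ blk-mirror (flipPt z) ⟨
        b′ (flipPt (flipPt z))     ≡⟨ cong b′ (flipPt-involutive z) ⟩
        b′ z                       ≡⟨ b′z≡b′y ⟩
        b′ (flipPt y)              ≡⟨ blk-mirror y ⟩
        b y                        ≡⟨ bx≡by ⟨
        b x                        ∎)
      where open ≡-Reasoning

  Cross-mirror : ∀ {x y} → Cross r x y → Cross r′ (flipPt y) (flipPt x)
  Cross-mirror {x} {y}
    (bx≢by , α , β , α′ , β′ , bα , bβ , bα′ , bβ′ , α≢β , α′≢β′ , α′∈αβ , β′∈βα)
    with β∈α′β′ , α∈β′α′ ← openInt-crossing r α≢β α′∈αβ β′∈βα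
    = (λ e → bx≢by (sym (trans (sym (blk-mirror y)) (trans e (blk-mirror x))))) ,
      flipPt β′ , flipPt α′ , flipPt β , flipPt α ,
      blk-mirror-≡ bβ′ , blk-mirror-≡ bα′ , blk-mirror-≡ bβ , blk-mirror-≡ bα ,
      flipPt-≢ (α′≢β′ ∘ sym) , flipPt-≢ (α≢β ∘ sym) ,
      trans (sym (openInt-mirror α′≢β′ β)) β∈α′β′ ,
      trans (sym (openInt-mirror (α′≢β′ ∘ sym) α)) α∈β′α′

  Fset-mirror : ∀ {n} → Fset r n → Fset r′ n
  Fset-mirror (x , size) = flipPt x ,
    trans (length-keep-flipPt r′ (blockOf r′ (flipPt x)))
          (trans (cong length (keep-allPts-cong r (block-mirror x))) size)

  Vset-mirror : ∀ {v} → Vset r v → Vset r′ (- v)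
  Vset-mirror (x , σ≡v) =
    flipPt x , trans (σ-mirror _) (cong -_ (trans (σ-cong r (block-mirror x)) σ≡v))

  Σset-mirror : ∀ {v} → Σset r v → Σset r′ (- v)
  Σset-mirror Σ≡v = trans (σ-mirror _) (cong -_ Σ≡v)

  Lset-mirror : ∀ {v} → Lset r v → Lset r′ (- v)
  Lset-mirror (x , y , consec , w≢0 , δ≡v) =
    flipPt y , flipPt x , Consec-mirror consec ,
    w≢0 ∘ neg-injective {j = 0ℤ} ∘ trans (sym (wt-pair-mirror x y)) ,
    trans (δ-mirror x y) (cong -_ δ≡v)

  Kset-mirror : ∀ {v} → Kset r v → Kset r′ (- v)
  Kset-mirror (x , y , consec , w≡0 , δ≡v) =
    flipPt y , flipPt x , Consec-mirror consec ,
    trans (wt-pair-mirror x y) (cong -_ w≡0) ,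
    trans (δ-mirror x y) (cong -_ δ≡v)

  Xset-mirror : ∀ {v} → Xset r v → Xset r′ (- v)
  Xset-mirror (x , y , cross , δ≡v) =
    flipPt y , flipPt x , Cross-mirror cross , trans (δ-mirror x y) (cong -_ δ≡v)

mirror-⇔ : {A B : ℤ → Set} → (∀ {v} → A v → B (- v)) → (∀ {v} → B v → A (- v)) →
  ∀ v → A v ⇔ B (- v)
mirror-⇔ {A} A→B B→A v = mk⇔ A→B (subst A (neg-involutive v) ∘ B→A)

lemma6p4 : (p : Partition) →
    ((n : ℕ) → Fset (verticolor p) n ⇔ Fset p n) ×
    ((v : ℤ) → Vset (verticolor p) v ⇔ Vset p (- v)) ×
    ((v : ℤ) → Σset (verticolor p) v ⇔ Σset p (- v)) ×
    ((v : ℤ) → Lset (verticolor p) v ⇔ Lset p (- v)) ×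
    ((v : ℤ) → Kset (verticolor p) v ⇔ Kset p (- v)) ×
    ((v : ℤ) → Xset (verticolor p) v ⇔ Xset p (- v))
lemma6p4 (part k l c b) =
  (λ _ → mk⇔ q→p.Fset-mirror p→q.Fset-mirror) ,
  mirror-⇔ q→p.Vset-mirror p→q.Vset-mirror ,
  mirror-⇔ q→p.Σset-mirror p→q.Σset-mirror ,
  mirror-⇔ q→p.Lset-mirror p→q.Lset-mirror ,
  mirror-⇔ q→p.Kset-mirror p→q.Kset-mirror ,
  mirror-⇔ q→p.Xset-mirror p→q.Xset-mirror
  where
  module q→p = Mirror {c′ = c} {b′ = b}
    (λ x → sym (trans (cong invert (ncol-verticolor c b x)) (invert-involutive _))) (λ _ → refl)
  module p→q = Mirror {c = c} {b = b}
    (λ x → trans (ncol-verticolor c b (flipPt x))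
                 (cong (invert ∘ ncol (part k l c b)) (flipPt-involutive x)))
    (λ x → cong b (flipPt-involutive x))
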